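{- Let $\mathcal{I}$ be a T-maximal ideal on $\mathbb{N}$. Then for any $A,B\subseteq\mathbb{N}$ with $A,B\notin\mathcal{I}$ there is $k\in\mathbb{Z}$ with $(A+k)\cap B\notin\mathcal{I}$. In particular, there is no $\mathcal{I}$-TAD family of cardinality $\mathfrak{c}$.
   Context: For $A\subseteq\mathbb{N}$ and $k\in\mathbb{Z}$, $A+k$ denotes $\{a+k:a\in A\}\cap\mathbb{N}$. An ideal on $\mathbb{N}$ is a family $\mathcal{I}\subseteq\mathcal{P}(\mathbb{N})$ closed under finite unions and subsets, containing all finite subsets of $\mathbb{N}$, with $\mathbb{N}\notin\mathcal{I}$; it is translation invariant if $A+k\in\mathcal{I}$ for all $A\in\mathcal{I}$, $k\in\mathbb{Z}$. A translation invariant ideal $\mathcal{I}$ is T-maximal if for every translation invariant ideal $\mathcal{J}$, $\mathcal{I}\subseteq\mathcal{J}$ implies $\mathcal{I}=\mathcal{J}$. $\mathcal{I}^+=\{A\subseteq\mathbb{N}:A\notin\mathcal{I}\}$. A family $\mathcal{A}\subseteq\mathcal{P}(\mathbb{N})$ is an $\mathcal{I}$-TAD family if $\mathcal{A}\subseteq\mathcal{I}^+$ and $A\cap(B+k)\in\mathcal{I}$ for all distinct $A,B\in\mathcal{A}$ and all $k\in\mathbb{Z}$. $\mathfrak{c}$ is the cardinality of the continuum. -}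

module Defs where

open import Level using (0ℓ)
open import Data.Nat using (ℕ; _<_)
open import Data.Integer as ℤ using (ℤ; +_)
open import Data.Product using (Σ; ∃; _×_; _,_)
open import Relation.Nullary using (¬_)
open import Relation.Binary.PropositionalEquality using (_≡_)
open import Relation.Unary using (Pred; _⊆_; _∩_; _∪_; U)

Subset : Set₁
Subset = Pred ℕ 0ℓ

Family : Set₁
Family = Subset → Set

-- A + k = {a + k : a ∈ A} ∩ ℕ, for k ∈ ℤ.
_⊕_ : Subset → ℤ → Subset
(A ⊕ k) x = Σ ℕ λ a → A a × ((+ a) ℤ.+ k ≡ + x)

Finite : Subset → Set
Finite A = Σ ℕ λ n → ∀ {x} → A x → x < n

record IsIdeal (I : Family) : Set₁ where
  field
    union-closed  : ∀ A B → I A → I B → I (A ∪ B)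
    subset-closed : ∀ A B → A ⊆ B → I B → I A
    finite-in     : ∀ A → Finite A → I A
    proper        : ¬ I U

TranslationInvariant : Family → Set₁
TranslationInvariant I = ∀ A (k : ℤ) → I A → I (A ⊕ k)

record IsTInvIdeal (I : Family) : Set₁ where
  field
    isIdeal : IsIdeal I
    tinv    : TranslationInvariant I

_⊑_ : Family → Family → Set₁
I ⊑ J = ∀ A → I A → J A

IsTMaximal : Family → Set₁
IsTMaximal I = IsTInvIdeal I × (∀ J → IsTInvIdeal J → I ⊑ J → J ⊑ I)

IsTADFamily : {X : Set} → Family → (X → Subset) → Set
IsTADFamily {X} I F =
  (∀ x → ¬ I (F x)) ×
  (∀ x y → ¬ x ≡ y → ∀ (k : ℤ) → I (F x ∩ (F y ⊕ k)))

-- Suppose every translate of A meets B in a set of I. Adding A to I generates the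
-- translation invariant family of sets C with C ∖ (A + k₁ ∪ … ∪ A + kₙ) ∈ I. It is
-- proper, since B would otherwise be covered by a set of I together with the sets
-- (A + kᵢ) ∩ B ∈ I. So it is a translation invariant ideal above I containing A,
-- and T-maximality forces A ∈ I. Two distinct members of a TAD family would be such
-- a pair A, B, so every TAD family has at most one member.
module Submission where

open import Defs
open import Data.Nat using (ℕ)
open import Data.Nat.Properties using (+-identityʳ)
open import Data.Bool using (Bool; true; false)
open import Data.Integer using (ℤ; +_; _+_)
open import Data.Integer.Properties using (+-assoc)
open import Data.List using (List; []; _∷_; _++_; map)
open import Data.List.Relation.Unary.Any as Any using (Any; here; there)
open import Data.List.Relation.Unary.Any.Properties using (++⁺ˡ; ++⁺ʳ; map⁺)
open import Data.Product using (∃; _×_; _,_; proj₁; swap)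
open import Data.Sum using (inj₁; inj₂)
open import Relation.Nullary using (¬_; yes; no)
open import Relation.Binary.PropositionalEquality using (_≡_; _≢_; sym; trans; cong)
open import Relation.Unary using (_⊆_; _∩_; _∪_; _∖_; ∅; U)
open import Axiom.ExcludedMiddle using (ExcludedMiddle)
open import Axiom.DoubleNegationElimination using (em⇒dne)
open import Level using (0ℓ)

Translates : Subset → List ℤ → Subset
Translates A ks x = Any (λ k → (A ⊕ k) x) ks

⊕-⊕ : ∀ A j k {c y} → (A ⊕ j) c → + c + k ≡ + y → (A ⊕ (j + k)) y
⊕-⊕ A j k (a , a∈A , a+j≡c) c+k≡y =
  a , a∈A , trans (sym (+-assoc (+ a) j k)) (trans (cong (_+ k) a+j≡c) c+k≡y)

⊆-⊕0 : ∀ A → A ⊆ A ⊕ (+ 0)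
⊆-⊕0 A {x} x∈A = x , x∈A , cong +_ (+-identityʳ x)

_+Translates_ : Family → Subset → Family
(I +Translates A) C = ∃ λ ks → I (C ∖ Translates A ks)

TranslatesAlmostDisjoint : Family → Subset → Subset → Set
TranslatesAlmostDisjoint I A B = ∀ k → I ((A ⊕ k) ∩ B)

module _ {I : Family} (isIdeal : IsIdeal I) where
  open IsIdeal isIdeal

  ∅∈ : I ∅
  ∅∈ = finite-in ∅ (0 , λ ())

  Translates-∩-∈ : ∀ {A B} → TranslatesAlmostDisjoint I A B → ∀ ks → I (Translates A ks ∩ B)
  Translates-∩-∈ disjoint []       = subset-closed _ ∅ (λ ()) ∅∈
  Translates-∩-∈ disjoint (k ∷ ks) =
    subset-closed _ _ split (union-closed _ _ (disjoint k) (Translates-∩-∈ disjoint ks))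
    where
    split : Translates _ (k ∷ ks) ∩ _ ⊆ ((_ ⊕ k) ∩ _) ∪ (Translates _ ks ∩ _)
    split (here x∈A⊕k , x∈B) = inj₁ (x∈A⊕k , x∈B)
    split (there x∈T , x∈B)  = inj₂ (x∈T , x∈B)

  ⊑-+Translates : ∀ A → I ⊑ (I +Translates A)
  ⊑-+Translates A C C∈I = [] , subset-closed _ _ proj₁ C∈I

  ∈-+Translates : ∀ A → (I +Translates A) A
  ∈-+Translates A = (+ 0 ∷ []) ,
    subset-closed _ ∅ (λ (x∈A , x∉T) → x∉T (here (⊆-⊕0 A x∈A))) ∅∈

  +Translates-isIdeal : ExcludedMiddle 0ℓ → ∀ {A B} → ¬ I B →
    TranslatesAlmostDisjoint I A B → IsIdeal (I +Translates A)
  +Translates-isIdeal em {A} {B} B∉I disjoint = record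
    { union-closed  = λ C D (ks , C∖∈) (ls , D∖∈) →
        ks ++ ls , subset-closed _ _ (∖-++ {C} {D} ks ls) (union-closed _ _ C∖∈ D∖∈)
    ; subset-closed = λ C D C⊆D (ks , D∖∈) →
        ks , subset-closed _ _ (λ (x∈C , x∉T) → C⊆D x∈C , x∉T) D∖∈
    ; finite-in     = λ C C-finite → [] , subset-closed _ _ proj₁ (finite-in C C-finite)
    ; proper        = λ (ks , U∖∈) →
        B∉I (subset-closed _ _ (cover ks) (union-closed _ _ U∖∈ (Translates-∩-∈ disjoint ks)))
    }
    where
    ∖-++ : ∀ {C D : Subset} ks ls →
      (C ∪ D) ∖ Translates A (ks ++ ls) ⊆ (C ∖ Translates A ks) ∪ (D ∖ Translates A ls)
    ∖-++ ks ls (inj₁ x∈C , x∉T) = inj₁ (x∈C , λ x∈T → x∉T (++⁺ˡ x∈T))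
    ∖-++ ks ls (inj₂ x∈D , x∉T) = inj₂ (x∈D , λ x∈T → x∉T (++⁺ʳ ks x∈T))

    cover : ∀ ks → B ⊆ (U ∖ Translates A ks) ∪ (Translates A ks ∩ B)
    cover ks {x} x∈B with em {Translates A ks x}
    ... | yes x∈T = inj₂ (x∈T , x∈B)
    ... | no  x∉T = inj₁ (_ , x∉T)

+Translates-tinv : ∀ {I} A → IsIdeal I → TranslationInvariant I →
  TranslationInvariant (I +Translates A)
+Translates-tinv A isIdeal tinv C k (ks , C∖∈) =
  map (_+ k) ks , subset-closed _ _ shift (tinv _ k C∖∈)
  where
  open IsIdeal isIdeal
  shift : (C ⊕ k) ∖ Translates A (map (_+ k) ks) ⊆ (C ∖ Translates A ks) ⊕ k
  shift ((c , c∈C , c+k≡y) , y∉T) =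
    c , (c∈C , λ c∈T → y∉T (map⁺ (Any.map (λ {j} c∈A⊕j → ⊕-⊕ A j k c∈A⊕j c+k≡y) c∈T))) , c+k≡y

TranslatesMeet : Family → Set₁
TranslatesMeet I = (A B : Subset) → ¬ I A → ¬ I B → ∃ λ (k : ℤ) → ¬ I ((A ⊕ k) ∩ B)

TMaximal⇒TranslatesMeet : ExcludedMiddle 0ℓ → ∀ {I} → IsTMaximal I → TranslatesMeet I
TMaximal⇒TranslatesMeet em {I} (tInvIdeal , maximal) A B A∉I B∉I =
  em⇒dne em λ noMeet → A∉I (maximal (I +Translates A) (tInvIdeal′ noMeet)
                                    (⊑-+Translates isIdeal A) A (∈-+Translates isIdeal A))
  where
  open IsTInvIdeal tInvIdeal
  tInvIdeal′ : ¬ (∃ λ k → ¬ I ((A ⊕ k) ∩ B)) → IsTInvIdeal (I +Translates A)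
  tInvIdeal′ noMeet = record
    { isIdeal = +Translates-isIdeal isIdeal em B∉I λ k → em⇒dne em λ k∉ → noMeet (k , k∉)
    ; tinv    = +Translates-tinv A isIdeal tinv
    }

TranslatesMeet⇒¬TADFamily : ∀ {I X} {F : X → Subset} → IsIdeal I → TranslatesMeet I →
  ∀ x y → x ≢ y → ¬ IsTADFamily I F
TranslatesMeet⇒¬TADFamily {F = F} isIdeal meet x y x≢y (F∉I , almostDisjoint)
  with meet (F y) (F x) (F∉I y) (F∉I x)
... | k , meet∉I = meet∉I (subset-closed _ _ swap (almostDisjoint x y x≢y k))
  where open IsIdeal isIdeal

theorem3p10 : ExcludedMiddle 0ℓ → (I : Family) → IsTMaximal I →
    ((A B : Subset) → ¬ I A → ¬ I B → ∃ λ (k : ℤ) → ¬ I ((A ⊕ k) ∩ B))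
    × ((F : (ℕ → Bool) → Subset) → ¬ IsTADFamily I F)
theorem3p10 em I tMaximal@(tInvIdeal , _) =
  meet , λ F → TranslatesMeet⇒¬TADFamily isIdeal meet (λ _ → true) (λ _ → false) true≢false
  where
  open IsTInvIdeal tInvIdeal
  meet : TranslatesMeet I
  meet = TMaximal⇒TranslatesMeet em tMaximal
  true≢false : (λ (_ : ℕ) → true) ≢ (λ _ → false)
  true≢false eq with cong (λ f → f 0) eq
  ... | ()
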